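{- Let $\mathbb{F}$ be any field and let $f(x_1,\ldots,x_n)$ be computed by a diagonal depth-4 circuit $\Phi=\sum_{i=1}^k\Psi_i$ with $\Psi_i=\vec P_i^{\vec e_i}$. Then there is a read-once oblivious ABP computing $f$ with variable order $x_1<\cdots<x_n$, of depth $n$ and width $\le k\cdot\max_{i\in[k]}|\vec e_i|_\times$, whose edges are labeled by univariate polynomials of degree $\le\mathrm{sdeg}(f)$.
   Context: A diagonal depth-4 circuit has the form $\Phi=\sum_{i=1}^k\Psi_i$ with $\Psi_i=\prod_jP_{i,j}^{e_{i,j}}$. Each $P_{i,j}=\sum_{m=1}^ng_{i,j,m}(x_m)$ is a sum of univariate polynomials. $\mathrm{sdeg}(f)=\max_i\deg(\Psi_i)$, where $\deg(\Psi_i)=\sum_je_{i,j}\deg(P_{i,j})$. For $\vec e\in\mathbb{N}^t$, $|\vec e|_\times=\prod_j(1+e_j)$. An ABP is a layered directed acyclic graph with levels $0,\ldots,n$, a single source at level $0$ and a single sink at level $n$. It computes the sum, over source-to-sink paths, of the product of the edge labels, and its width is the maximum number of vertices in a level. It is read-once oblivious with order $x_1<\cdots<x_n$ if the edges from level $j-1$ to level $j$ are labeled by univariate polynomials in $x_j$. -}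

module Defs where

open import Level using (Level)
open import Algebra.Bundles using (CommutativeRing)
open import Data.Nat as ℕ using (ℕ; zero; suc; _∸_; _≤_; _<_; _⊔_)
open import Data.Bool using (Bool; true; false; if_then_else_; _∧_)
open import Data.Fin using (Fin; zero; suc; fromℕ<)
open import Data.Vec using (Vec; []; _∷_; lookup)
open import Data.List using (List; []; _∷_; upTo; concatMap; map; foldr)
open import Data.Product using (_×_; _,_; Σ; ∃)
open import Relation.Nullary using (¬_)
open import Relation.Binary.PropositionalEquality using (_≡_)
import Data.Fin
import Data.Nat.Properties as ℕ

record Field (c ℓ : Level) : Set (Level.suc (c Level.⊔ ℓ)) where
  field
    ring : CommutativeRing c ℓ
  open CommutativeRing ring
  field
    1≉0     : ¬ (1# ≈ 0#)
    inverse : ∀ x → ¬ (x ≈ 0#) → Σ Carrier (λ y → x * y ≈ 1#)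

sumℕ : (m : ℕ) → (Fin m → ℕ) → ℕ
sumℕ zero    f = 0
sumℕ (suc m) f = f zero ℕ.+ sumℕ m (λ i → f (suc i))

prodℕ : (m : ℕ) → (Fin m → ℕ) → ℕ
prodℕ zero    f = 1
prodℕ (suc m) f = f zero ℕ.* prodℕ m (λ i → f (suc i))

maxℕ : (m : ℕ) → (Fin m → ℕ) → ℕ
maxℕ zero    f = 0
maxℕ (suc m) f = f zero ⊔ maxℕ m (λ i → f (suc i))

∣_∣× : ∀ {t} → (Fin t → ℕ) → ℕ
∣_∣× {t} e = prodℕ t (λ j → suc (e j))

Mon : ℕ → Set
Mon n = Vec ℕ n

isZero : ℕ → Bool
isZero zero    = true
isZero (suc _) = false

allZero : ∀ {n} → Mon n → Bool
allZero []      = true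
allZero (k ∷ m) = isZero k ∧ allZero m

only : ∀ {n} → Fin n → Mon n → Bool
only zero    (k ∷ m) = allZero m
only (suc j) (k ∷ m) = isZero k ∧ only j m

tdeg : ∀ {n} → Mon n → ℕ
tdeg []      = 0
tdeg (k ∷ m) = k ℕ.+ tdeg m

-- all pairs (a , b) of monomials with a · b = m
splits : ∀ {n} → Mon n → List (Mon n × Mon n)
splits []      = ([] , []) ∷ []
splits (k ∷ m) =
  concatMap (λ i → map (λ { (a , b) → (i ∷ a , (k ∸ i) ∷ b) }) (splits m))
            (upTo (suc k))

module Poly {c ℓ : Level} (R : CommutativeRing c ℓ) where
  open CommutativeRing R using (Carrier; _≈_; _+_; _*_; 0#; 1#)

  -- univariate polynomials: coefficient lists (index = exponent)
  UPoly : Set c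
  UPoly = List Carrier

  coeffU : UPoly → ℕ → Carrier
  coeffU []       _       = 0#
  coeffU (a ∷ as) zero    = a
  coeffU (a ∷ as) (suc i) = coeffU as i

  UDegLe : ℕ → UPoly → Set ℓ
  UDegLe d g = ∀ i → d < i → coeffU g i ≈ 0#

  -- multivariate polynomials in x_1 … x_n: coefficient of each monomial
  -- (formal polynomials; equality is coefficientwise)
  MPoly : ℕ → Set c
  MPoly n = Mon n → Carrier

  _≈P_ : ∀ {n} → MPoly n → MPoly n → Set ℓ
  p ≈P q = ∀ m → p m ≈ q m

  zeroP : ∀ {n} → MPoly n
  zeroP _ = 0#

  oneP : ∀ {n} → MPoly n
  oneP m = if allZero m then 1# else 0#

  _+P_ : ∀ {n} → MPoly n → MPoly n → MPoly n
  (p +P q) m = p m + q m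

  _*P_ : ∀ {n} → MPoly n → MPoly n → MPoly n
  (p *P q) m = foldr (λ { (a , b) s → p a * q b + s }) 0# (splits m)

  _^P_ : ∀ {n} → MPoly n → ℕ → MPoly n
  p ^P zero  = oneP
  p ^P suc e = p *P (p ^P e)

  ΣP : ∀ {n} (m : ℕ) → (Fin m → MPoly n) → MPoly n
  ΣP zero    f = zeroP
  ΣP (suc m) f = f zero +P ΣP m (λ i → f (suc i))

  ΠP : ∀ {n} (m : ℕ) → (Fin m → MPoly n) → MPoly n
  ΠP zero    f = oneP
  ΠP (suc m) f = f zero *P ΠP m (λ i → f (suc i))

  embed : ∀ {n} → Fin n → UPoly → MPoly n
  embed j g m = if only j m then coeffU g (lookup m j) else 0#

  DegLe : ∀ {n} → ℕ → MPoly n → Set ℓ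
  DegLe d p = ∀ m → d < tdeg m → p m ≈ 0#

  record Diag4 (n : ℕ) : Set c where
    field
      k : ℕ
      t : Fin k → ℕ
      e : (i : Fin k) → Fin (t i) → ℕ
      g : (i : Fin k) → Fin (t i) → Fin n → UPoly

    P : (i : Fin k) → Fin (t i) → MPoly n
    P i j = ΣP n (λ m → embed m (g i j m))

    Ψ : Fin k → MPoly n
    Ψ i = ΠP (t i) (λ j → P i j ^P e i j)

    value : MPoly n
    value = ΣP k Ψ

    widthBound : ℕ
    widthBound = k ℕ.* maxℕ k (λ i → ∣ e i ∣×)

  -- Levels 0 … n; level ℓ has w ℓ vertices; the single source is the
  -- vertex of level 0, the single sink the vertex of level n.  Between
  -- consecutive levels ℓ, ℓ+1 (ℓ < n) every pair (a , b) carries a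
  -- univariate polynomial label in x_{ℓ+1} (the zero label = no edge).

  record ROABP (n : ℕ) : Set c where
    field
      w      : ℕ → ℕ
      source : w 0 ≡ 1
      sink   : w n ≡ 1
      label  : (l : ℕ) → l < n → Fin (w l) → Fin (w (suc l)) → UPoly

    -- reach l a = sum over paths from the source to vertex a of level l
    -- of the product of the edge labels
    reach : (l : ℕ) → l ≤ n → Fin (w l) → MPoly n
    reach zero    _  _ = oneP
    reach (suc l) lt b =
      ΣP (w l) (λ a → reach l (ℕ.<⇒≤ lt) a *P embed (fromℕ< lt) (label l lt a b))

    value : MPoly n
    value = ΣP (w n) (reach n ℕ.≤-refl)

    width : ℕ
    width = maxℕ (suc n) (λ l → w (Data.Fin.toℕ l))

    depth : ℕ
    depth = n

    LabelDegLe : ℕ → Set ℓ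
    LabelDegLe d = ∀ l (lt : l < n) a b → UDegLe d (label l lt a b)

module Submission where

-- Write S_{i,j,l} = g_{i,j,1}(x_1) + ⋯ + g_{i,j,l}(x_l) for the partial sums of P_{i,j}. For each
-- term Ψ_i the ABP keeps, after reading x_1, …, x_l, the |e_i|_× monomials ∏_j S_{i,j,l}^{a_j} with
-- 0 ≤ a ≤ e_i. Since S_{i,j,l+1} = S_{i,j,l} + g_{i,j,l+1}(x_{l+1}), the binomial theorem writes every
-- new monomial as a combination of the old ones whose coefficients ∏_j C(b_j, a_j) g_{i,j,l+1}^{b_j − a_j}
-- are univariate in x_{l+1} of degree ≤ Σ_j e_{i,j} deg P_{i,j} ≤ sdeg. Running the k terms side by side
-- gives width Σ_i |e_i|_× ≤ k · max_i |e_i|_×; at level n the monomial a = e_i of term i is Ψ_i itself.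

open import Level using (Level)
open import Algebra.Bundles using (CommutativeSemiring; CommutativeRing)
open import Algebra.Structures.Biased using (isCommutativeSemiringˡ)
open import Data.Bool using (Bool; true; false; if_then_else_)
open import Data.Bool.Properties using (T-≡)
open import Data.Empty using (⊥-elim)
open import Data.Fin as Fin using (Fin; zero; suc; toℕ; fromℕ<; _↑ˡ_; _↑ʳ_; combine; remQuot; splitAt)
import Data.Fin.Properties as Fin
open import Data.List using (List; []; _∷_; foldr; _++_; concatMap; map; applyUpTo; upTo)
open import Data.Nat as ℕ using (ℕ; zero; suc; _∸_; _≤_; _<_; z≤n; s≤s)
open import Data.Nat.Combinatorics using (_C_; k>n⇒nCk≡0)
import Data.Nat.Properties as ℕ
open import Data.Product using (Σ; _×_; _,_; proj₁; proj₂)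
open import Data.Sum using (_⊎_; inj₁; inj₂; [_,_])
open import Data.Vec using ([]; _∷_; lookup; replicate; zipWith)
open import Function using (_∘_)
open import Function.Bundles using (Equivalence)
open import Relation.Binary.PropositionalEquality as ≡ using (_≡_)
open import Relation.Binary.Structures using (IsEquivalence)
open import Relation.Nullary using (¬_; yes; no)

open import Defs

allZero⇒only : ∀ {n} (j : Fin n) (m : Mon n) → allZero m ≡ true → only j m ≡ true
allZero⇒only zero    (zero ∷ m)  m≡0 = m≡0
allZero⇒only (suc j) (zero ∷ m)  m≡0 = allZero⇒only j m m≡0
allZero⇒only j       (suc _ ∷ m) ()

allZero⇒tdeg≡0 : ∀ {n} (m : Mon n) → allZero m ≡ true → tdeg m ≡ 0
allZero⇒tdeg≡0 []          _   = ≡.refl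
allZero⇒tdeg≡0 (zero ∷ m)  m≡0 = allZero⇒tdeg≡0 m m≡0
allZero⇒tdeg≡0 (suc _ ∷ m) ()

allZero≡false⇒0<tdeg : ∀ {n} (m : Mon n) → allZero m ≡ false → 0 < tdeg m
allZero≡false⇒0<tdeg (zero ∷ m)  m≢0 = allZero≡false⇒0<tdeg m m≢0
allZero≡false⇒0<tdeg (suc _ ∷ m) _   = s≤s z≤n

only≡false⇒0<tdeg : ∀ {n} (j : Fin n) (m : Mon n) → only j m ≡ false → 0 < tdeg m
only≡false⇒0<tdeg zero    (k ∷ m)     m≢x^ = ℕ.<-≤-trans (allZero≡false⇒0<tdeg m m≢x^) (ℕ.m≤n+m (tdeg m) k)
only≡false⇒0<tdeg (suc j) (zero ∷ m)  m≢x^ = only≡false⇒0<tdeg j m m≢x^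
only≡false⇒0<tdeg (suc j) (suc _ ∷ m) _    = s≤s z≤n

only-unique : ∀ {n} (j j′ : Fin n) (m : Mon n) → only j m ≡ true → only j′ m ≡ true → ¬ j ≡ j′ → allZero m ≡ true
only-unique zero    zero     m           _  _  j≢j′ = ⊥-elim (j≢j′ ≡.refl)
only-unique zero    (suc j′) (zero ∷ m)  h  _  _    = h
only-unique zero    (suc j′) (suc _ ∷ m) _  ()
only-unique (suc j) zero     (zero ∷ m)  _  h′ _    = h′
only-unique (suc j) zero     (suc _ ∷ m) ()
only-unique (suc j) (suc j′) (zero ∷ m)  h  h′ j≢j′ = only-unique j j′ m h h′ (j≢j′ ∘ ≡.cong suc)
only-unique (suc j) (suc j′) (suc _ ∷ m) ()

allZero-zipWith : ∀ {n} (a b : Mon n) → allZero a ≡ true → allZero b ≡ true → allZero (zipWith ℕ._+_ a b) ≡ true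
allZero-zipWith []           []           _   _   = ≡.refl
allZero-zipWith (zero ∷ a)   (zero ∷ b)   a≡0 b≡0 = allZero-zipWith a b a≡0 b≡0
allZero-zipWith (zero ∷ a)   (suc _ ∷ b)  _   ()
allZero-zipWith (suc _ ∷ a)  (_ ∷ b)      ()  _

only-zipWith : ∀ {n} (j : Fin n) (a b : Mon n) → only j a ≡ true → only j b ≡ true → only j (zipWith ℕ._+_ a b) ≡ true
only-zipWith zero    (_ ∷ a)     (_ ∷ b)     ha hb = allZero-zipWith a b ha hb
only-zipWith (suc j) (zero ∷ a)  (zero ∷ b)  ha hb = only-zipWith j a b ha hb
only-zipWith (suc j) (zero ∷ a)  (suc _ ∷ b) _  ()
only-zipWith (suc j) (suc _ ∷ a) (_ ∷ b)     ()

tdeg-zipWith : ∀ {n} (a b : Mon n) → tdeg (zipWith ℕ._+_ a b) ≡ tdeg a ℕ.+ tdeg b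
tdeg-zipWith []      []      = ≡.refl
tdeg-zipWith (x ∷ a) (y ∷ b) rewrite tdeg-zipWith a b = interchange x y (tdeg a) (tdeg b)
  where open import Algebra.Properties.CommutativeSemigroup ℕ.+-commutativeSemigroup using (interchange)

varPower : ∀ {n} → Fin n → ℕ → Mon n
varPower {suc n} zero    i = i ∷ replicate n 0
varPower         (suc j) i = 0 ∷ varPower j i

only⇒varPower : ∀ {n} (j : Fin n) (m : Mon n) → only j m ≡ true → m ≡ varPower j (lookup m j)
only⇒varPower zero    (k ∷ m)     m≡0 = ≡.cong (k ∷_) (allZero⇒replicate m m≡0)
  where
  allZero⇒replicate : ∀ {n} (m : Mon n) → allZero m ≡ true → m ≡ replicate n 0
  allZero⇒replicate []          _   = ≡.refl
  allZero⇒replicate (zero ∷ m)  m≡0 = ≡.cong (0 ∷_) (allZero⇒replicate m m≡0)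
  allZero⇒replicate (suc _ ∷ m) ()
only⇒varPower (suc j) (zero ∷ m)  h   = ≡.cong (0 ∷_) (only⇒varPower j m h)
only⇒varPower (suc j) (suc _ ∷ m) ()

tdeg-varPower : ∀ {n} (j : Fin n) i → tdeg (varPower j i) ≡ i
tdeg-varPower {suc n} zero    i = ≡.trans (≡.cong (i ℕ.+_) (tdeg-replicate n)) (ℕ.+-identityʳ i)
  where
  tdeg-replicate : ∀ n → tdeg (replicate n 0) ≡ 0
  tdeg-replicate zero    = ≡.refl
  tdeg-replicate (suc n) = tdeg-replicate n
tdeg-varPower (suc j) i = tdeg-varPower j i

-- Mixed-radix and block indices

digits : ∀ {t} (e : Fin t → ℕ) → Fin ∣ e ∣× → Fin t → ℕ
digits e x zero    = toℕ (proj₁ (remQuot {suc (e zero)} ∣ e ∘ suc ∣× x))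
digits e x (suc j) = digits (e ∘ suc) (proj₂ (remQuot {suc (e zero)} ∣ e ∘ suc ∣× x)) j

digits-≤ : ∀ {t} (e : Fin t → ℕ) x j → digits e x j ≤ e j
digits-≤ e x zero    = ℕ.≤-pred (Fin.toℕ<n (proj₁ (remQuot {suc (e zero)} ∣ e ∘ suc ∣× x)))
digits-≤ e x (suc j) = digits-≤ (e ∘ suc) _ j

top : ∀ {t} (e : Fin t → ℕ) → Fin ∣ e ∣×
top {zero}  e = zero
top {suc t} e = combine (Fin.fromℕ (e zero)) (top (e ∘ suc))

digits-top : ∀ {t} (e : Fin t → ℕ) j → digits e (top e) j ≡ e j
digits-top e zero    =
  ≡.trans (≡.cong (toℕ ∘ proj₁) (Fin.remQuot-combine (Fin.fromℕ (e zero)) (top (e ∘ suc))))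
          (Fin.toℕ-fromℕ (e zero))
digits-top e (suc j) =
  ≡.trans (≡.cong (λ p → digits (e ∘ suc) (proj₂ p) j) (Fin.remQuot-combine (Fin.fromℕ (e zero)) (top (e ∘ suc))))
          (digits-top (e ∘ suc) j)

Block : ∀ k → (Fin k → ℕ) → Set
Block k M = Σ (Fin k) (Fin ∘ M)

fromBlock : ∀ k (M : Fin k → ℕ) → Block k M → Fin (sumℕ k M)
fromBlock (suc k) M (zero  , x) = x ↑ˡ sumℕ k (M ∘ suc)
fromBlock (suc k) M (suc i , x) = M zero ↑ʳ fromBlock k (M ∘ suc) (i , x)

toBlock : ∀ k (M : Fin k → ℕ) → Fin (sumℕ k M) → Block k M
toBlock (suc k) M s =
  [ (λ x → zero , x) , (λ y → let (i , x) = toBlock k (M ∘ suc) y in suc i , x) ] (splitAt (M zero) s)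

toBlock-fromBlock : ∀ k M (b : Block k M) → toBlock k M (fromBlock k M b) ≡ b
toBlock-fromBlock (suc k) M (zero , x) rewrite Fin.splitAt-↑ˡ (M zero) x (sumℕ k (M ∘ suc)) = ≡.refl
toBlock-fromBlock (suc k) M (suc i , x)
  rewrite Fin.splitAt-↑ʳ (M zero) (sumℕ k (M ∘ suc)) (fromBlock k (M ∘ suc) (i , x))
        | toBlock-fromBlock k (M ∘ suc) (i , x) = ≡.refl

maxℕ-lub : ∀ m (f : Fin m → ℕ) {B} → (∀ i → f i ≤ B) → maxℕ m f ≤ B
maxℕ-lub zero    f f≤B = z≤n
maxℕ-lub (suc m) f f≤B = ℕ.⊔-lub (f≤B zero) (maxℕ-lub m (f ∘ suc) (f≤B ∘ suc))

sumℕ-mono : ∀ m {f g : Fin m → ℕ} → (∀ i → f i ≤ g i) → sumℕ m f ≤ sumℕ m g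
sumℕ-mono zero    f≤g = z≤n
sumℕ-mono (suc m) f≤g = ℕ.+-mono-≤ (f≤g zero) (sumℕ-mono m (f≤g ∘ suc))

sumℕ≤*maxℕ : ∀ m (f : Fin m → ℕ) → sumℕ m f ≤ m ℕ.* maxℕ m f
sumℕ≤*maxℕ zero    f = z≤n
sumℕ≤*maxℕ (suc m) f = ℕ.+-mono-≤ (ℕ.m≤m⊔n (f zero) _)
  (ℕ.≤-trans (sumℕ≤*maxℕ m (f ∘ suc)) (ℕ.*-monoʳ-≤ m (ℕ.m≤n⊔m (f zero) _)))

1≤∣∣× : ∀ {t} (e : Fin t → ℕ) → 1 ≤ ∣ e ∣×
1≤∣∣× {zero}  e = s≤s z≤n
1≤∣∣× {suc t} e = ℕ.≤-trans (1≤∣∣× (e ∘ suc)) (ℕ.m≤m+n _ _)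

1≤sumℕ : ∀ m (f : Fin m → ℕ) → 1 ≤ m → (∀ i → 1 ≤ f i) → 1 ≤ sumℕ m f
1≤sumℕ (suc m) f _ 1≤f = ℕ.≤-trans (1≤f zero) (ℕ.m≤m+n _ _)

<ᵇ-irrefl : ∀ m → (m ℕ.<ᵇ m) ≡ false
<ᵇ-irrefl zero    = ≡.refl
<ᵇ-irrefl (suc m) = <ᵇ-irrefl m

module Sums {c ℓ} (S : CommutativeSemiring c ℓ) where
  open CommutativeSemiring S hiding (zero)
  open import Algebra.Properties.Semiring.Sum semiring public
  open import Algebra.Properties.Semiring.Exp semiring public using (_^_; ^-cong; ^-congˡ)
  open import Algebra.Properties.Monoid.Sum *-monoid public using () renaming (sum-cong-≋ to product-cong)
  open import Algebra.Properties.Semiring.Mult semiring using () renaming (_×_ to _×ₙ_)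
  open import Algebra.Definitions.RawSemiring rawSemiring public using (product)
  open import Algebra.Properties.CommutativeSemigroup +-commutativeSemigroup using () renaming (interchange to +-interchange)
  open import Relation.Binary.Reasoning.Setoid setoid

  listSum : ∀ {a} {A : Set a} → (A → Carrier) → List A → Carrier
  listSum f = foldr (λ x s → f x + s) 0#

  module _ {a} {A : Set a} where

    listSum-cong : ∀ {f g : A → Carrier} xs → (∀ x → f x ≈ g x) → listSum f xs ≈ listSum g xs
    listSum-cong []       f≈g = refl
    listSum-cong (x ∷ xs) f≈g = +-cong (f≈g x) (listSum-cong xs f≈g)

    listSum-zero : ∀ (f : A → Carrier) xs → (∀ x → f x ≈ 0#) → listSum f xs ≈ 0#
    listSum-zero f []       f≈0 = refl
    listSum-zero f (x ∷ xs) f≈0 = trans (+-cong (f≈0 x) (listSum-zero f xs f≈0)) (+-identityʳ 0#)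

    listSum-distrib-+ : ∀ (f g : A → Carrier) xs → listSum (λ x → f x + g x) xs ≈ listSum f xs + listSum g xs
    listSum-distrib-+ f g []       = sym (+-identityʳ 0#)
    listSum-distrib-+ f g (x ∷ xs) = trans (+-congˡ (listSum-distrib-+ f g xs)) (+-interchange _ _ _ _)

    *-distribˡ-listSum : ∀ y (f : A → Carrier) xs → y * listSum f xs ≈ listSum (λ x → y * f x) xs
    *-distribˡ-listSum y f []       = zeroʳ y
    *-distribˡ-listSum y f (x ∷ xs) = trans (distribˡ y _ _) (+-congˡ (*-distribˡ-listSum y f xs))

    *-distribʳ-listSum : ∀ y (f : A → Carrier) xs → listSum f xs * y ≈ listSum (λ x → f x * y) xs
    *-distribʳ-listSum y f []       = zeroˡ y
    *-distribʳ-listSum y f (x ∷ xs) = trans (distribʳ y _ _) (+-congˡ (*-distribʳ-listSum y f xs))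

    listSum-++ : ∀ (f : A → Carrier) xs ys → listSum f (xs ++ ys) ≈ listSum f xs + listSum f ys
    listSum-++ f []       ys = sym (+-identityˡ _)
    listSum-++ f (x ∷ xs) ys = trans (+-congˡ (listSum-++ f xs ys)) (sym (+-assoc _ _ _))

    listSum-concatMap : ∀ {b} {B : Set b} (f : A → Carrier) (h : B → List A) ys →
                        listSum f (concatMap h ys) ≈ listSum (listSum f ∘ h) ys
    listSum-concatMap f h []       = refl
    listSum-concatMap f h (y ∷ ys) = trans (listSum-++ f (h y) (concatMap h ys)) (+-congˡ (listSum-concatMap f h ys))

    listSum-map : ∀ {b} {B : Set b} (f : A → Carrier) (h : B → A) ys → listSum f (map h ys) ≡ listSum (f ∘ h) ys
    listSum-map f h []       = ≡.refl
    listSum-map f h (y ∷ ys) = ≡.cong (f (h y) +_) (listSum-map f h ys)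

  listSum-comm : ∀ {a b} {A : Set a} {B : Set b} (F : A → B → Carrier) xs ys →
                 listSum (λ x → listSum (F x) ys) xs ≈ listSum (λ y → listSum (λ x → F x y) xs) ys
  listSum-comm F []       ys = sym (listSum-zero _ ys (λ _ → refl))
  listSum-comm F (x ∷ xs) ys = trans (+-congˡ (listSum-comm F xs ys)) (sym (listSum-distrib-+ _ _ ys))

  rangeSum : ℕ → (ℕ → Carrier) → Carrier
  rangeSum zero    f = 0#
  rangeSum (suc N) f = f 0 + rangeSum N (f ∘ suc)

  listSum-upTo : ∀ N (f : ℕ → Carrier) → listSum f (upTo N) ≡ rangeSum N f
  listSum-upTo N f = go N (λ i → i)
    where
    go : ∀ N (h : ℕ → ℕ) → listSum f (applyUpTo h N) ≡ rangeSum N (f ∘ h)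
    go zero    h = ≡.refl
    go (suc N) h = ≡.cong (f (h 0) +_) (go N (h ∘ suc))

  rangeSum-cong : ∀ N {f g} → (∀ i → i < N → f i ≈ g i) → rangeSum N f ≈ rangeSum N g
  rangeSum-cong zero    f≈g = refl
  rangeSum-cong (suc N) f≈g = +-cong (f≈g 0 (s≤s z≤n)) (rangeSum-cong N (λ i i<N → f≈g (suc i) (s≤s i<N)))

  rangeSum-zero : ∀ N f → (∀ i → i < N → f i ≈ 0#) → rangeSum N f ≈ 0#
  rangeSum-zero N f f≈0 = trans (rangeSum-cong N f≈0) (go N)
    where
    go : ∀ N → rangeSum N (λ _ → 0#) ≈ 0#
    go zero    = refl
    go (suc N) = trans (+-congˡ (go N)) (+-identityʳ 0#)

  rangeSum-distrib-+ : ∀ N f g → rangeSum N (λ i → f i + g i) ≈ rangeSum N f + rangeSum N g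
  rangeSum-distrib-+ zero    f g = sym (+-identityʳ 0#)
  rangeSum-distrib-+ (suc N) f g = trans (+-congˡ (rangeSum-distrib-+ N _ _)) (+-interchange _ _ _ _)

  rangeSum-snoc : ∀ N f → rangeSum (suc N) f ≈ rangeSum N f + f N
  rangeSum-snoc zero    f = trans (+-identityʳ _) (sym (+-identityˡ _))
  rangeSum-snoc (suc N) f = trans (+-congˡ (rangeSum-snoc N (f ∘ suc))) (sym (+-assoc _ _ _))

  rangeSum-reverse : ∀ N f → rangeSum N f ≈ rangeSum N (λ i → f (N ∸ suc i))
  rangeSum-reverse zero    f = refl
  rangeSum-reverse (suc N) f = begin
    f 0 + rangeSum N (f ∘ suc)                    ≈⟨ +-congˡ (rangeSum-reverse N (f ∘ suc)) ⟩
    f 0 + rangeSum N (λ i → f (suc (N ∸ suc i)))  ≈⟨ +-comm _ _ ⟩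
    rangeSum N (λ i → f (suc (N ∸ suc i))) + f 0
      ≈⟨ +-cong (rangeSum-cong N (λ i i<N → reflexive (≡.cong f (≡.sym (ℕ.+-∸-assoc 1 i<N)))))
                (reflexive (≡.cong f (≡.sym (ℕ.n∸n≡0 N)))) ⟩
    rangeSum N (λ i → f (N ∸ i)) + f (N ∸ N)      ≈⟨ rangeSum-snoc N _ ⟨
    rangeSum (suc N) (λ i → f (suc N ∸ suc i))    ∎

  rangeSum-antidiagonal : ∀ k (f : ℕ → ℕ → Carrier) →
    rangeSum (suc k) (λ i → f i (k ∸ i)) ≈ rangeSum (suc k) (λ i → f (k ∸ i) i)
  rangeSum-antidiagonal k f = trans (rangeSum-reverse (suc k) (λ i → f i (k ∸ i)))
    (rangeSum-cong (suc k) (λ i i≤k → reflexive (≡.cong (f (k ∸ i)) (ℕ.m∸[m∸n]≡n (ℕ.≤-pred i≤k)))))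

  rangeSum-triangle : ∀ k (f : ℕ → ℕ → ℕ → Carrier) →
    rangeSum (suc k) (λ i → rangeSum (suc i) (λ j → f j (i ∸ j) (k ∸ i))) ≈
    rangeSum (suc k) (λ j → rangeSum (suc (k ∸ j)) (λ i → f j i (k ∸ j ∸ i)))
  rangeSum-triangle zero    f = refl
  rangeSum-triangle (suc k) f = begin
    rangeSum (suc (suc k)) (λ i → f 0 i (suc k ∸ i) + rangeSum i (λ j → f (suc j) (i ∸ suc j) (suc k ∸ i)))
      ≈⟨ rangeSum-distrib-+ (suc (suc k)) (λ i → f 0 i (suc k ∸ i)) (λ i → rangeSum i (λ j → f (suc j) (i ∸ suc j) (suc k ∸ i))) ⟩
    rangeSum (suc (suc k)) (λ i → f 0 i (suc k ∸ i)) + (0# + rangeSum (suc k) (λ i → rangeSum (suc i) (λ j → f (suc j) (i ∸ j) (k ∸ i))))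
      ≈⟨ +-congˡ (trans (+-identityˡ _) (rangeSum-triangle k (f ∘ suc))) ⟩
    rangeSum (suc (suc k)) (λ i → f 0 i (suc k ∸ i)) + rangeSum (suc k) (λ j → rangeSum (suc (k ∸ j)) (λ i → f (suc j) i (k ∸ j ∸ i))) ∎

  rangeSum-extend : ∀ N M f → N ≤ M → (∀ i → N ≤ i → f i ≈ 0#) → rangeSum N f ≈ rangeSum M f
  rangeSum-extend zero    M       f _         f≈0 = sym (rangeSum-zero M f (λ i _ → f≈0 i z≤n))
  rangeSum-extend (suc N) (suc M) f (s≤s N≤M) f≈0 = +-congˡ (rangeSum-extend N M (f ∘ suc) N≤M (λ i N≤i → f≈0 (suc i) (s≤s N≤i)))

  sum-toℕ : ∀ N (f : ℕ → Carrier) → sum {N} (f ∘ toℕ) ≈ rangeSum N f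
  sum-toℕ zero    f = refl
  sum-toℕ (suc N) f = +-congˡ (sum-toℕ N (f ∘ suc))

  sum-zero : ∀ {N} (f : Fin N → Carrier) → (∀ i → f i ≈ 0#) → sum f ≈ 0#
  sum-zero {N} f f≈0 = trans (sum-cong-≋ f≈0) (sum-replicate-zero N)

  sum-single : ∀ {N} (f : Fin N → Carrier) i₀ → (∀ i → ¬ i ≡ i₀ → f i ≈ 0#) → sum f ≈ f i₀
  sum-single f zero     f≈0 = trans (+-congˡ (sum-zero (f ∘ suc) (λ i → f≈0 (suc i) (λ ())))) (+-identityʳ _)
  sum-single f (suc i₀) f≈0 = trans (+-congʳ (f≈0 zero (λ ()))) (trans (+-identityˡ _)
    (sum-single (f ∘ suc) i₀ (λ i i≢i₀ → f≈0 (suc i) (i≢i₀ ∘ Fin.suc-injective))))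

  *-sum : ∀ {M N} (f : Fin M → Carrier) (g : Fin N → Carrier) → sum f * sum g ≈ ∑[ i < M ] ∑[ j < N ] (f i * g j)
  *-sum f g = trans (*-distribʳ-sum _ f) (sum-cong-≋ (λ i → *-distribˡ-sum (f i) g))

  sum-*-assoc : ∀ {M N} (x : Fin M → Carrier) (A : Fin M → Fin N → Carrier) (y : Fin N → Carrier) →
    ∑[ b < N ] ((∑[ a < M ] (x a * A a b)) * y b) ≈ ∑[ a < M ] (x a * ∑[ b < N ] (A a b * y b))
  sum-*-assoc {M} {N} x A y = begin
    ∑[ b < N ] ((∑[ a < M ] (x a * A a b)) * y b) ≈⟨ sum-cong-≋ (λ b → *-distribʳ-sum (y b) (λ a → x a * A a b)) ⟩
    ∑[ b < N ] ∑[ a < M ] (x a * A a b * y b)      ≈⟨ ∑-comm (λ b a → x a * A a b * y b) ⟩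
    ∑[ a < M ] ∑[ b < N ] (x a * A a b * y b)      ≈⟨ sum-cong-≋ (λ a → sum-cong-≋ (λ b → *-assoc (x a) (A a b) (y b))) ⟩
    ∑[ a < M ] ∑[ b < N ] (x a * (A a b * y b))    ≈⟨ sum-cong-≋ (λ a → *-distribˡ-sum (x a) (λ b → A a b * y b)) ⟨
    ∑[ a < M ] (x a * ∑[ b < N ] (A a b * y b))    ∎

  sum-↑ : ∀ M {N} (f : Fin (M ℕ.+ N) → Carrier) → sum f ≈ sum (λ i → f (i ↑ˡ N)) + sum (λ j → f (M ↑ʳ j))
  sum-↑ zero    f = sym (+-identityˡ _)
  sum-↑ (suc M) f = trans (+-congˡ (sum-↑ M (f ∘ suc))) (sym (+-assoc _ _ _))

  sum-combine : ∀ M {N} (f : Fin (M ℕ.* N) → Carrier) → sum f ≈ ∑[ i < M ] ∑[ j < N ] f (combine i j)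
  sum-combine zero        f = refl
  sum-combine (suc M) {N} f = trans (sum-↑ N f) (+-congˡ (sum-combine M (f ∘ (N ↑ʳ_))))

  sum-blocks : ∀ k M (F : Block k M → Carrier) → sum (F ∘ toBlock k M) ≈ ∑[ i < k ] ∑[ x < M i ] F (i , x)
  sum-blocks k M F = trans (go k M (F ∘ toBlock k M))
    (sum-cong-≋ (λ i → sum-cong-≋ (λ x → reflexive (≡.cong F (toBlock-fromBlock k M (i , x))))))
    where
    go : ∀ k M (f : Fin (sumℕ k M) → Carrier) → sum f ≈ ∑[ i < k ] ∑[ x < M i ] f (fromBlock k M (i , x))
    go zero    M f = refl
    go (suc k) M f = trans (sum-↑ (M zero) f) (+-congˡ (go k (M ∘ suc) _))

  pad : ∀ {M} → (Fin M → Carrier) → ℕ → Carrier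
  pad {zero}  f _       = 0#
  pad {suc M} f zero    = f zero
  pad {suc M} f (suc l) = pad (f ∘ suc) l

  pad-fromℕ< : ∀ {M} (f : Fin M → Carrier) {l} (l<M : l < M) → pad f l ≡ f (fromℕ< l<M)
  pad-fromℕ< {suc M} f {zero}  _         = ≡.refl
  pad-fromℕ< {suc M} f {suc l} (s≤s l<M) = pad-fromℕ< (f ∘ suc) l<M

  prefixSum : ∀ {M} → (Fin M → Carrier) → ℕ → Carrier
  prefixSum f zero    = 0#
  prefixSum f (suc l) = prefixSum f l + pad f l

  prefixSum-total : ∀ {M} (f : Fin M → Carrier) → prefixSum f M ≈ sum f
  prefixSum-total {M} f = trans (prefix≈rangeSum M) (rangeSum-pad f)
    where
    prefix≈rangeSum : ∀ l → prefixSum f l ≈ rangeSum l (pad f)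
    prefix≈rangeSum zero    = refl
    prefix≈rangeSum (suc l) = trans (+-congʳ (prefix≈rangeSum l)) (sym (rangeSum-snoc l (pad f)))
    rangeSum-pad : ∀ {M} (f : Fin M → Carrier) → rangeSum M (pad f) ≈ sum f
    rangeSum-pad {zero}  f = refl
    rangeSum-pad {suc M} f = +-congˡ (rangeSum-pad (f ∘ suc))

  module _ {p} (Q : Carrier → Set p) (Q0 : Q 0#) (Q+ : ∀ {x y} → Q x → Q y → Q (x + y)) where

    sum-closed : ∀ {N} (f : Fin N → Carrier) → (∀ i → Q (f i)) → Q (sum f)
    sum-closed {zero}  f Qf = Q0
    sum-closed {suc N} f Qf = Q+ (Qf zero) (sum-closed (f ∘ suc) (Qf ∘ suc))

    pad-closed : ∀ {M} (f : Fin M → Carrier) → (∀ i → Q (f i)) → ∀ l → Q (pad f l)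
    pad-closed {zero}  f Qf _       = Q0
    pad-closed {suc M} f Qf zero    = Qf zero
    pad-closed {suc M} f Qf (suc l) = pad-closed (f ∘ suc) (Qf ∘ suc) l

    ×-closed : ∀ n {x} → Q x → Q (n ×ₙ x)
    ×-closed zero    Qx = Q0
    ×-closed (suc n) Qx = Q+ Qx (×-closed n Qx)

  module _ {p} (Q : Carrier → Set p) (Q1 : Q 1#) (Q* : ∀ {x y} → Q x → Q y → Q (x * y)) where

    product-closed : ∀ {N} (f : Fin N → Carrier) → (∀ i → Q (f i)) → Q (product f)
    product-closed {zero}  f Qf = Q1
    product-closed {suc N} f Qf = Q* (Qf zero) (product-closed (f ∘ suc) (Qf ∘ suc))

    ^-closed : ∀ {x} n → Q x → Q (x ^ n)
    ^-closed zero    Qx = Q1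
    ^-closed (suc n) Qx = Q* Qx (^-closed n Qx)

-- The binomial shift of monomials

module BinomialShift {c ℓ} (S : CommutativeSemiring c ℓ) where
  open CommutativeSemiring S hiding (zero)
  open Sums S
  open import Algebra.Properties.Semiring.Mult semiring using (×-comm-*) renaming (_×_ to _×ₙ_)
  import Algebra.Properties.CommutativeSemiring.Binomial S as Binomial
  open import Algebra.Properties.CommutativeSemigroup *-commutativeSemigroup using (interchange)
  open import Relation.Binary.Reasoning.Setoid setoid

  -- coefficient of x ^ a in (x + y) ^ b
  shiftTerm : ℕ → ℕ → Carrier → Carrier
  shiftTerm b a y = (b C a) ×ₙ (y ^ (b ∸ a))

  binomial-padded : ∀ x y {b} e → b ≤ e → rangeSum (suc e) (λ a → x ^ a * shiftTerm b a y) ≈ (x + y) ^ b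
  binomial-padded x y {b} e b≤e = begin
    rangeSum (suc e) term
      ≈⟨ rangeSum-extend (suc b) (suc e) term (s≤s b≤e) (λ a b<a →
           trans (*-congˡ (reflexive (≡.cong (λ c → c ×ₙ (y ^ (b ∸ a))) (k>n⇒nCk≡0 b<a)))) (zeroʳ _)) ⟨
    rangeSum (suc b) term
      ≈⟨ rangeSum-cong (suc b) (λ a _ → ×-comm-* (b C a) (x ^ a) (y ^ (b ∸ a))) ⟩
    rangeSum (suc b) (λ a → (b C a) ×ₙ (x ^ a * y ^ (b ∸ a))) ≈⟨ sum-toℕ (suc b) (λ a → (b C a) ×ₙ (x ^ a * y ^ (b ∸ a))) ⟨
    Binomial.binomialExpansion x y b                          ≈⟨ Binomial.theorem b x y ⟨
    (x + y) ^ b                                               ∎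
    where term = λ a → x ^ a * shiftTerm b a y

  monomial : ∀ {t} (e : Fin t → ℕ) → (Fin t → Carrier) → Fin ∣ e ∣× → Carrier
  monomial e s x = product (λ j → s j ^ digits e x j)

  shift : ∀ {t} (e : Fin t → ℕ) → (Fin t → Carrier) → Fin ∣ e ∣× → Fin ∣ e ∣× → Carrier
  shift e g x y = product (λ j → shiftTerm (digits e y j) (digits e x j) (g j))

  monomial-shift : ∀ {t} (e : Fin t → ℕ) (s g : Fin t → Carrier) y →
    ∑[ x < ∣ e ∣× ] (monomial e s x * shift e g x y) ≈ monomial e (λ j → s j + g j) y
  monomial-shift {zero}  e s g y = trans (+-identityʳ _) (*-identityˡ _)
  monomial-shift {suc t} e s g y = begin
    ∑[ x < suc (e zero) ℕ.* M ] (monomial e s x * shift e g x y)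
      ≈⟨ sum-cong-≋ {suc (e zero) ℕ.* M} (λ x → interchange _ _ _ _) ⟩
    ∑[ x < suc (e zero) ℕ.* M ] H (remQuot M x)
      ≈⟨ sum-combine (suc (e zero)) {M} (H ∘ remQuot M) ⟩
    ∑[ a < suc (e zero) ] ∑[ r < M ] H (remQuot M (combine a r))
      ≈⟨ sum-cong-≋ {suc (e zero)} (λ a → sum-cong-≋ {M} (λ r → reflexive (≡.cong H (Fin.remQuot-combine a r)))) ⟩
    ∑[ a < suc (e zero) ] ∑[ r < M ] (A (toℕ a) * B r)        ≈⟨ *-sum {suc (e zero)} {M} (A ∘ toℕ) B ⟨
    (∑[ a < suc (e zero) ] A (toℕ a)) * (∑[ r < M ] B r)
      ≈⟨ *-cong (trans (sum-toℕ (suc (e zero)) A) (binomial-padded (s zero) (g zero) (e zero) (digits-≤ e y zero)))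
                (monomial-shift (e ∘ suc) (s ∘ suc) (g ∘ suc) y′) ⟩
    monomial e (λ j → s j + g j) y ∎
    where
    M  = ∣ e ∘ suc ∣×
    y₀ = digits e y zero
    y′ = proj₂ (remQuot M y)
    A  = λ a → s zero ^ a * shiftTerm y₀ a (g zero)
    B  = λ r → monomial (e ∘ suc) (s ∘ suc) r * shift (e ∘ suc) (g ∘ suc) r y′
    H  = λ p → A (toℕ (proj₁ p)) * B (proj₂ p)

-- The polynomial semiring

module Polynomials {c ℓ} (R : CommutativeRing c ℓ) where
  open CommutativeRing R hiding (zero)
  open Poly R
  open Sums commutativeSemiring
  open import Relation.Binary.Reasoning.Setoid setoid

  convolve : ∀ {n} → (Mon n → Mon n → Carrier) → Mon n → Carrier
  convolve F m = listSum (λ ab → F (proj₁ ab) (proj₂ ab)) (splits m)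

  convolve-∷ : ∀ {n} (F : Mon (suc n) → Mon (suc n) → Carrier) k m →
    convolve F (k ∷ m) ≈ rangeSum (suc k) (λ i → convolve (λ a b → F (i ∷ a) ((k ∸ i) ∷ b)) m)
  convolve-∷ F k m = begin
    convolve F (k ∷ m)
      ≈⟨ listSum-concatMap _ (λ i → map (λ { (a , b) → (i ∷ a , (k ∸ i) ∷ b) }) (splits m)) (upTo (suc k)) ⟩
    listSum (λ i → listSum (λ ab → F (proj₁ ab) (proj₂ ab)) (map _ (splits m))) (upTo (suc k))
      ≈⟨ listSum-cong (upTo (suc k)) (λ i → reflexive (listSum-map _ _ (splits m))) ⟩
    listSum (λ i → convolve (λ a b → F (i ∷ a) ((k ∸ i) ∷ b)) m) (upTo (suc k))
      ≡⟨ listSum-upTo (suc k) _ ⟩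
    rangeSum (suc k) (λ i → convolve (λ a b → F (i ∷ a) ((k ∸ i) ∷ b)) m) ∎

  convolve-cong : ∀ {n} {F G : Mon n → Mon n → Carrier} m → (∀ a b → F a b ≈ G a b) → convolve F m ≈ convolve G m
  convolve-cong m F≈G = listSum-cong (splits m) (λ ab → F≈G (proj₁ ab) (proj₂ ab))

  convolve-rangeSum : ∀ {n} N (F : Mon n → Mon n → ℕ → Carrier) m →
    convolve (λ a b → rangeSum N (F a b)) m ≈ rangeSum N (λ i → convolve (λ a b → F a b i) m)
  convolve-rangeSum N F m = begin
    convolve (λ a b → rangeSum N (F a b)) m
      ≈⟨ listSum-cong (splits m) (λ ab → reflexive (≡.sym (listSum-upTo N (F (proj₁ ab) (proj₂ ab))))) ⟩
    listSum (λ ab → listSum (F (proj₁ ab) (proj₂ ab)) (upTo N)) (splits m) ≈⟨ listSum-comm _ (splits m) (upTo N) ⟩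
    listSum (λ i → convolve (λ a b → F a b i) m) (upTo N)                   ≡⟨ listSum-upTo N _ ⟩
    rangeSum N (λ i → convolve (λ a b → F a b i) m)                        ∎

  convolve-swap : ∀ {n} (F : Mon n → Mon n → Carrier) m → convolve F m ≈ convolve (λ a b → F b a) m
  convolve-swap F []      = refl
  convolve-swap F (k ∷ m) = begin
    convolve F (k ∷ m)                               ≈⟨ convolve-∷ F k m ⟩
    rangeSum (suc k) (λ i → convolve (λ a b → F (i ∷ a) ((k ∸ i) ∷ b)) m)
      ≈⟨ rangeSum-cong (suc k) (λ i _ → convolve-swap (λ a b → F (i ∷ a) ((k ∸ i) ∷ b)) m) ⟩
    rangeSum (suc k) (λ i → G i (k ∸ i))             ≈⟨ rangeSum-antidiagonal k G ⟩
    rangeSum (suc k) (λ i → G (k ∸ i) i)             ≈⟨ convolve-∷ (λ a b → F b a) k m ⟨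
    convolve (λ a b → F b a) (k ∷ m)                 ∎
    where G = λ i j → convolve (λ a b → F (i ∷ b) (j ∷ a)) m

  convolve-assoc : ∀ {n} (F : Mon n → Mon n → Mon n → Carrier) m →
    convolve (λ ab c → convolve (λ a b → F a b c) ab) m ≈ convolve (λ a bc → convolve (λ b c → F a b c) bc) m
  convolve-assoc F []      = refl
  convolve-assoc F (k ∷ m) = begin
    convolve (λ ab c → convolve (λ a b → F a b c) ab) (k ∷ m) ≈⟨ convolve-∷ _ k m ⟩
    rangeSum (suc k) (λ i → convolve (λ ab c → convolve (λ a b → F a b ((k ∸ i) ∷ c)) (i ∷ ab)) m)
      ≈⟨ rangeSum-cong (suc k) (λ i _ → convolve-cong m (λ ab c → convolve-∷ (λ a b → F a b ((k ∸ i) ∷ c)) i ab)) ⟩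
    rangeSum (suc k) (λ i → convolve (λ ab c → rangeSum (suc i) (λ j → convolve (λ a b → F (j ∷ a) ((i ∸ j) ∷ b) ((k ∸ i) ∷ c)) ab)) m)
      ≈⟨ rangeSum-cong (suc k) (λ i _ → convolve-rangeSum (suc i) (λ ab c j → convolve (λ a b → F (j ∷ a) ((i ∸ j) ∷ b) ((k ∸ i) ∷ c)) ab) m) ⟩
    rangeSum (suc k) (λ i → rangeSum (suc i) (λ j → convolve (λ ab c → convolve (λ a b → F (j ∷ a) ((i ∸ j) ∷ b) ((k ∸ i) ∷ c)) ab) m))
      ≈⟨ rangeSum-cong (suc k) (λ i _ → rangeSum-cong (suc i) (λ j _ → convolve-assoc (λ a b c → F (j ∷ a) ((i ∸ j) ∷ b) ((k ∸ i) ∷ c)) m)) ⟩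
    rangeSum (suc k) (λ i → rangeSum (suc i) (λ j → G j (i ∸ j) (k ∸ i))) ≈⟨ rangeSum-triangle k G ⟩
    rangeSum (suc k) (λ j → rangeSum (suc (k ∸ j)) (λ i → G j i (k ∸ j ∸ i)))
      ≈⟨ rangeSum-cong (suc k) (λ j _ → convolve-rangeSum (suc (k ∸ j)) (λ a bc i → convolve (λ b c → F (j ∷ a) (i ∷ b) ((k ∸ j ∸ i) ∷ c)) bc) m) ⟨
    rangeSum (suc k) (λ j → convolve (λ a bc → rangeSum (suc (k ∸ j)) (λ i → convolve (λ b c → F (j ∷ a) (i ∷ b) ((k ∸ j ∸ i) ∷ c)) bc)) m)
      ≈⟨ rangeSum-cong (suc k) (λ j _ → convolve-cong m (λ a bc → convolve-∷ (λ b c → F (j ∷ a) b c) (k ∸ j) bc)) ⟨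
    rangeSum (suc k) (λ j → convolve (λ a bc → convolve (λ b c → F (j ∷ a) b c) ((k ∸ j) ∷ bc)) m) ≈⟨ convolve-∷ _ k m ⟨
    convolve (λ a bc → convolve (λ b c → F a b c) bc) (k ∷ m) ∎
    where G = λ x y z → convolve (λ a bc → convolve (λ b c → F (x ∷ a) (y ∷ b) (z ∷ c)) bc) m

  convolve-oneˡ : ∀ {n} (G : Mon n → Carrier) m → convolve (λ a b → oneP a * G b) m ≈ G m
  convolve-oneˡ G []      = trans (+-identityʳ _) (*-identityˡ _)
  convolve-oneˡ G (k ∷ m) = begin
    convolve (λ a b → oneP a * G b) (k ∷ m) ≈⟨ convolve-∷ _ k m ⟩
    convolve (λ a b → oneP a * G (k ∷ b)) m + rangeSum k (λ i → convolve (λ a b → 0# * G ((k ∸ suc i) ∷ b)) m)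
      ≈⟨ +-cong (convolve-oneˡ (G ∘ (k ∷_)) m)
                (rangeSum-zero k _ (λ i _ → listSum-zero _ (splits m) (λ ab → zeroˡ _))) ⟩
    G (k ∷ m) + 0#                          ≈⟨ +-identityʳ _ ⟩
    G (k ∷ m)                               ∎

  module _ {n : ℕ} where

    *P-cong : ∀ {p p′ q q′ : MPoly n} → p ≈P p′ → q ≈P q′ → (p *P q) ≈P (p′ *P q′)
    *P-cong p≈p′ q≈q′ m = convolve-cong m (λ a b → *-cong (p≈p′ a) (q≈q′ b))

    *P-assoc : ∀ (p q r : MPoly n) → ((p *P q) *P r) ≈P (p *P (q *P r))
    *P-assoc p q r m = begin
      convolve (λ ab c → (p *P q) ab * r c) m
        ≈⟨ convolve-cong m (λ ab c → *-distribʳ-listSum (r c) _ (splits ab)) ⟩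
      convolve (λ ab c → convolve (λ a b → p a * q b * r c) ab) m ≈⟨ convolve-assoc (λ a b c → p a * q b * r c) m ⟩
      convolve (λ a bc → convolve (λ b c → p a * q b * r c) bc) m
        ≈⟨ convolve-cong m (λ a bc → listSum-cong (splits bc) (λ _ → *-assoc _ _ _)) ⟩
      convolve (λ a bc → convolve (λ b c → p a * (q b * r c)) bc) m
        ≈⟨ convolve-cong m (λ a bc → *-distribˡ-listSum (p a) _ (splits bc)) ⟨
      convolve (λ a bc → p a * (q *P r) bc) m ∎

    *P-comm : ∀ (p q : MPoly n) → (p *P q) ≈P (q *P p)
    *P-comm p q m = trans (convolve-swap _ m) (convolve-cong m (λ a b → *-comm _ _))

    polynomialSemiring : CommutativeSemiring c ℓ
    polynomialSemiring = record
      { Carrier = MPoly n ; _≈_ = _≈P_ ; _+_ = _+P_ ; _*_ = _*P_ ; 0# = zeroP ; 1# = oneP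
      ; isCommutativeSemiring = isCommutativeSemiringˡ (record
        { +-isCommutativeMonoid = record
          { isMonoid = record
            { isSemigroup = record
              { isMagma = record { isEquivalence = ≈P-isEquivalence ; ∙-cong = λ p≈p′ q≈q′ m → +-cong (p≈p′ m) (q≈q′ m) }
              ; assoc = λ p q r m → +-assoc _ _ _ }
            ; identity = (λ p m → +-identityˡ _) , (λ p m → +-identityʳ _) }
          ; comm = λ p q m → +-comm _ _ }
        ; *-isCommutativeMonoid = record
          { isMonoid = record
            { isSemigroup = record
              { isMagma = record { isEquivalence = ≈P-isEquivalence ; ∙-cong = *P-cong }
              ; assoc = *P-assoc }
            ; identity = convolve-oneˡ , (λ p m → trans (*P-comm p oneP m) (convolve-oneˡ p m)) }
          ; comm = *P-comm }
        ; distribʳ = λ p q r m → trans (convolve-cong m (λ a b → distribʳ _ _ _)) (listSum-distrib-+ _ _ (splits m))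
        ; zeroˡ = λ p m → listSum-zero _ (splits m) (λ _ → zeroˡ _) })
      }
      where
      ≈P-isEquivalence : IsEquivalence (_≈P_ {n})
      ≈P-isEquivalence = record
        { refl = λ m → refl ; sym = λ p≈q m → sym (p≈q m) ; trans = λ p≈q q≈r m → trans (p≈q m) (q≈r m) }

  convolve-support : ∀ {n} (F : Mon n → Mon n → Carrier) m →
    (∀ a b → zipWith ℕ._+_ a b ≡ m → F a b ≈ 0#) → convolve F m ≈ 0#
  convolve-support F []      F≈0 = trans (+-congʳ (F≈0 [] [] ≡.refl)) (+-identityʳ 0#)
  convolve-support F (k ∷ m) F≈0 = trans (convolve-∷ F k m) (rangeSum-zero (suc k) _ (λ i i≤k →
    convolve-support _ m (λ a b a+b≡m → F≈0 (i ∷ a) ((k ∸ i) ∷ b) (≡.cong₂ _∷_ (ℕ.m+[n∸m]≡n (ℕ.≤-pred i≤k)) a+b≡m))))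

  *P-vanishes : ∀ {n} (V V₁ V₂ : Mon n → Set) → (∀ a b → V (zipWith ℕ._+_ a b) → V₁ a ⊎ V₂ b) →
    ∀ {p q} → (∀ m → V₁ m → p m ≈ 0#) → (∀ m → V₂ m → q m ≈ 0#) → ∀ m → V m → (p *P q) m ≈ 0#
  *P-vanishes V V₁ V₂ split {p} {q} p≈0 q≈0 m Vm = convolve-support _ m (λ a b a+b≡m →
    [ (λ V₁a → trans (*-congʳ (p≈0 a V₁a)) (zeroˡ _)) , (λ V₂b → trans (*-congˡ (q≈0 b V₂b)) (zeroʳ _)) ]
      (split a b (≡.subst V (≡.sym a+b≡m) Vm)))

  Univariate : ∀ {n} → Fin n → MPoly n → Set ℓ
  Univariate j p = ∀ m → only j m ≡ false → p m ≈ 0#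

  coeffU-within : ∀ (f : ℕ → Carrier) (h : ℕ → ℕ) N i → i < N → coeffU (map f (applyUpTo h N)) i ≡ f (h i)
  coeffU-within f h (suc N) zero    _         = ≡.refl
  coeffU-within f h (suc N) (suc i) (s≤s i<N) = coeffU-within f (h ∘ suc) N i i<N

  coeffU-beyond : ∀ (f : ℕ → Carrier) (h : ℕ → ℕ) N i → N ≤ i → coeffU (map f (applyUpTo h N)) i ≡ 0#
  coeffU-beyond f h zero    i       _         = ≡.refl
  coeffU-beyond f h (suc N) (suc i) (s≤s N≤i) = coeffU-beyond f (h ∘ suc) N i N≤i

  module _ {n : ℕ} where

    Univariate-+ : ∀ j {p q : MPoly n} → Univariate j p → Univariate j q → Univariate j (p +P q)
    Univariate-+ j p≈0 q≈0 m m≢x^ = trans (+-cong (p≈0 m m≢x^) (q≈0 m m≢x^)) (+-identityʳ 0#)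

    Univariate-* : ∀ j {p q : MPoly n} → Univariate j p → Univariate j q → Univariate j (p *P q)
    Univariate-* j = *P-vanishes (λ m → only j m ≡ false) _ _ split
      where
      split : ∀ a b → only j (zipWith ℕ._+_ a b) ≡ false → only j a ≡ false ⊎ only j b ≡ false
      split a b ab≢x^ with only j a in a≡x^ | only j b in b≡x^
      ... | false | _     = inj₁ ≡.refl
      ... | true  | false = inj₂ ≡.refl
      ... | true  | true  with ≡.trans (≡.sym (only-zipWith j a b a≡x^ b≡x^)) ab≢x^
      ... | ()

    Univariate-zeroP : ∀ j → Univariate j (zeroP {n})
    Univariate-zeroP j m _ = refl

    Univariate-oneP : ∀ j → Univariate j (oneP {n})
    Univariate-oneP j m m≢x^ with allZero m in m≡0
    ... | false = refl
    ... | true  with ≡.trans (≡.sym (allZero⇒only j m m≡0)) m≢x^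
    ... | ()

    DegLe-+ : ∀ d {p q : MPoly n} → DegLe d p → DegLe d q → DegLe d (p +P q)
    DegLe-+ d p≈0 q≈0 m d<m = trans (+-cong (p≈0 m d<m) (q≈0 m d<m)) (+-identityʳ 0#)

    DegLe-* : ∀ d₁ d₂ {p q : MPoly n} → DegLe d₁ p → DegLe d₂ q → DegLe (d₁ ℕ.+ d₂) (p *P q)
    DegLe-* d₁ d₂ = *P-vanishes (λ m → d₁ ℕ.+ d₂ < tdeg m) _ _ split
      where
      split : ∀ a b → d₁ ℕ.+ d₂ < tdeg (zipWith ℕ._+_ a b) → d₁ < tdeg a ⊎ d₂ < tdeg b
      split a b d<ab with d₁ ℕ.<? tdeg a | d₂ ℕ.<? tdeg b
      ... | yes d₁<a | _        = inj₁ d₁<a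
      ... | no _     | yes d₂<b = inj₂ d₂<b
      ... | no d₁≮a  | no d₂≮b  = ⊥-elim (ℕ.<⇒≱ d<ab (≡.subst (ℕ._≤ d₁ ℕ.+ d₂) (≡.sym (tdeg-zipWith a b))
                                    (ℕ.+-mono-≤ (ℕ.≮⇒≥ d₁≮a) (ℕ.≮⇒≥ d₂≮b))))

    DegLe-zeroP : ∀ d → DegLe d (zeroP {n})
    DegLe-zeroP d m _ = refl

    DegLe-oneP : DegLe 0 (oneP {n})
    DegLe-oneP m 0<m with allZero m in m≡0
    ... | false = refl
    ... | true  with ≡.subst (0 <_) (allZero⇒tdeg≡0 m m≡0) 0<m
    ... | ()

    DegLe-mono : ∀ {d d′} {p : MPoly n} → d ≤ d′ → DegLe d p → DegLe d′ p
    DegLe-mono d≤d′ p≈0 m d′<m = p≈0 m (ℕ.≤-<-trans d≤d′ d′<m)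

    Univariate-embed : ∀ j g → Univariate j (embed {n} j g)
    Univariate-embed j g m m≢x^ rewrite m≢x^ = refl

    constant⇒Univariate : ∀ j {p : MPoly n} → DegLe 0 p → Univariate j p
    constant⇒Univariate j p≈0 m m≢x^ = p≈0 m (only≡false⇒0<tdeg j m m≢x^)

    toUnivariate : ℕ → Fin n → MPoly n → UPoly
    toUnivariate D j p = map (p ∘ varPower j) (upTo (suc D))

    toUnivariate-degree : ∀ D j (p : MPoly n) → UDegLe D (toUnivariate D j p)
    toUnivariate-degree D j p i D<i = reflexive (coeffU-beyond (p ∘ varPower j) (λ x → x) (suc D) i D<i)

    embed-toUnivariate : ∀ D j {p : MPoly n} → Univariate j p → DegLe D p → embed j (toUnivariate D j p) ≈P p
    embed-toUnivariate D j {p} p-univ p-deg m with only j m in m≡x^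
    ... | false = sym (p-univ m m≡x^)
    ... | true  with lookup m j ℕ.≤? D
    ...   | yes m≤D = reflexive (≡.trans (coeffU-within (p ∘ varPower j) (λ x → x) (suc D) _ (s≤s m≤D))
                                         (≡.cong p (≡.sym (only⇒varPower j m m≡x^))))
    ...   | no  m≰D = trans (reflexive (coeffU-beyond (p ∘ varPower j) (λ x → x) (suc D) _ (ℕ.≰⇒> m≰D)))
                            (sym (p-deg m (≡.subst (D <_) tdeg-m (ℕ.≰⇒> m≰D))))
      where
      tdeg-m : lookup m j ≡ tdeg m
      tdeg-m = ≡.trans (≡.sym (tdeg-varPower j (lookup m j))) (≡.cong tdeg (≡.sym (only⇒varPower j m m≡x^)))

    ΣP-apply : ∀ N (f : Fin N → MPoly n) m → ΣP N f m ≈ ∑[ i < N ] f i m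
    ΣP-apply zero    f m = refl
    ΣP-apply (suc N) f m = +-congˡ (ΣP-apply N (f ∘ suc) m)

    -- On a non-constant monomial only the summand g_v(x_v) of Σ_v g_v(x_v) can contribute.
    DegLe-summand : ∀ d (g : Fin n → UPoly) → DegLe d (ΣP n (λ v → embed v (g v))) → ∀ v → DegLe d (embed v (g v))
    DegLe-summand d g P-deg v m d<m with only v m in m≡x^
    ... | false = refl
    ... | true  = begin
      coeffU (g v) (lookup m v)        ≡⟨ ≡.cong (λ b → if b then coeffU (g v) (lookup m v) else 0#) m≡x^ ⟨
      embed v (g v) m                  ≈⟨ sum-single (λ v′ → embed v′ (g v′) m) v other-summands-vanish ⟨
      ∑[ v′ < n ] embed v′ (g v′) m    ≈⟨ ΣP-apply n (λ v′ → embed v′ (g v′)) m ⟨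
      ΣP n (λ v′ → embed v′ (g v′)) m  ≈⟨ P-deg m d<m ⟩
      0#                               ∎
      where
      other-summands-vanish : ∀ v′ → ¬ v′ ≡ v → embed v′ (g v′) m ≈ 0#
      other-summands-vanish v′ v′≢v with only v′ m in m≡x′^
      ... | false = refl
      ... | true  = ⊥-elim (ℕ.<⇒≱ d<m (≡.subst (_≤ d) (≡.sym (allZero⇒tdeg≡0 m (only-unique v′ v m m≡x′^ m≡x^ v′≢v))) z≤n))

    ΣP≈sum : ∀ N (f : Fin N → MPoly n) → ΣP N f ≈P Sums.sum polynomialSemiring f
    ΣP≈sum zero    f m = refl
    ΣP≈sum (suc N) f m = +-congˡ (ΣP≈sum N (f ∘ suc) m)

    ΠP≈product : ∀ N (f : Fin N → MPoly n) → ΠP N f ≈P Sums.product polynomialSemiring f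
    ΠP≈product zero    f m = refl
    ΠP≈product (suc N) f   = *P-cong {p = f zero} (λ _ → refl) (ΠP≈product N (f ∘ suc))

    ^P≈^ : ∀ (p : MPoly n) e → (p ^P e) ≈P Sums._^_ polynomialSemiring p e
    ^P≈^ p zero    m = refl
    ^P≈^ p (suc e)   = *P-cong {p = p} (λ _ → refl) (^P≈^ p e)

module PolynomialDegree {c ℓ} (R : CommutativeRing c ℓ) (n : ℕ) where
  open Poly R using (MPoly; DegLe)
  open Polynomials R
  open CommutativeSemiring (polynomialSemiring {n}) hiding (zero)
  open Sums (polynomialSemiring {n})

  DegLe-^ : ∀ d {p} c → DegLe d p → DegLe (c ℕ.* d) (p ^ c)
  DegLe-^ d zero    _     = DegLe-oneP
  DegLe-^ d (suc c) p-deg = DegLe-* d (c ℕ.* d) p-deg (DegLe-^ d c p-deg)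

  DegLe-product : ∀ {M} (δ : Fin M → ℕ) (f : Fin M → MPoly n) →
                  (∀ i → DegLe (δ i) (f i)) → DegLe (sumℕ M δ) (product f)
  DegLe-product {zero}  δ f _     = DegLe-oneP
  DegLe-product {suc M} δ f f-deg =
    DegLe-* (δ zero) _ (f-deg zero) (DegLe-product (δ ∘ suc) (f ∘ suc) (f-deg ∘ suc))

-- Read-once oblivious ABPs computing matrix products

module MatrixProductROABP {c ℓ} (R : CommutativeRing c ℓ) (n′ N : ℕ)
  (u v : Fin N → Poly.MPoly R (suc n′)) (T : ℕ → Fin N → Fin N → Poly.MPoly R (suc n′)) where
  open Poly R using (MPoly; ΣP; embed; _*P_; ROABP; DegLe)
  open Polynomials R
  open CommutativeSemiring (polynomialSemiring {suc n′}) hiding (zero)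
  open Sums (polynomialSemiring {suc n′})
  open import Relation.Binary.Reasoning.Setoid setoid

  n : ℕ
  n = suc n′

  rowProduct : ℕ → Fin N → MPoly n
  rowProduct zero      = u
  rowProduct (suc l) b = ∑[ a < N ] (rowProduct l a * T l a b)

  result : MPoly n
  result = ∑[ b < N ] (rowProduct n b * v b)

  -- Level l + 1 is interior iff l < n′; interior levels carry the N coordinates of the row vector,
  -- while the first and the last layer of edges absorb u and v into single source and sink vertices.
  layerWidth : Bool → ℕ
  layerWidth true  = N
  layerWidth false = 1

  width : ℕ → ℕ
  width zero    = 1
  width (suc l) = layerWidth (l ℕ.<ᵇ n′)

  levelValue : ℕ → (interior : Bool) → Fin (layerWidth interior) → MPoly n
  levelValue l true    = rowProduct l
  levelValue l false _ = ∑[ b < N ] (rowProduct l b * v b)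

  vertexValue : (l : ℕ) → Fin (width l) → MPoly n
  vertexValue zero    _ = 1#
  vertexValue (suc l)   = levelValue (suc l) (l ℕ.<ᵇ n′)

  laterEdge : ℕ → (β γ : Bool) → Fin (layerWidth β) → Fin (layerWidth γ) → MPoly n
  laterEdge l true  true      = T l
  laterEdge l true  false a _ = ∑[ b < N ] (T l a b * v b)
  laterEdge l false _     _ _ = 0#

  edge : (l : ℕ) → Fin (width l) → Fin (width (suc l)) → MPoly n
  edge zero    _ = vertexValue 1
  edge (suc l)   = laterEdge (suc l) (l ℕ.<ᵇ n′) (suc l ℕ.<ᵇ n′)

  vertexValue-step : ∀ l → l < n → ∀ b →
    vertexValue (suc l) b ≈ ∑[ a < width l ] (vertexValue l a * edge l a b)
  vertexValue-step zero    _          b = sym (trans (+-identityʳ _) (*-identityˡ _))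
  vertexValue-step (suc l) (s≤s l<n′) b =
    interior (l ℕ.<ᵇ n′) (suc l ℕ.<ᵇ n′) (Equivalence.to T-≡ (ℕ.<⇒<ᵇ l<n′)) b
    where
    interior : ∀ β γ → β ≡ true → ∀ b →
      levelValue (suc (suc l)) γ b ≈ ∑[ a < layerWidth β ] (levelValue (suc l) β a * laterEdge (suc l) β γ a b)
    interior true true  _ b = refl
    interior true false _ _ = sum-*-assoc (rowProduct (suc l)) (T (suc l)) v

  module Construction (D : ℕ) (u-constant : ∀ a → DegLe 0 (u a)) (v-constant : ∀ b → DegLe 0 (v b))
           (T-univariate : ∀ l (l<n : l < n) a b → Univariate (fromℕ< l<n) (T l a b))
           (T-degree : ∀ l → l < n → ∀ a b → DegLe D (T l a b)) where

    Label : Fin n → MPoly n → Set ℓ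
    Label j p = Univariate j p × DegLe D p

    Label-sum : ∀ j {M} (f : Fin M → MPoly n) → (∀ i → Label j (f i)) → Label j (sum f)
    Label-sum j = sum-closed (Label j) (Univariate-zeroP j , DegLe-zeroP D)
      (λ (p-univ , p-deg) (q-univ , q-deg) → Univariate-+ j p-univ q-univ , DegLe-+ D p-deg q-deg)

    constant-*-Label : ∀ j {p q} → DegLe 0 p → Label j q → Label j (p * q)
    constant-*-Label j p-const (q-univ , q-deg) =
      Univariate-* j (constant⇒Univariate j p-const) q-univ , DegLe-* 0 D p-const q-deg

    Label-*-constant : ∀ j {p q} → Label j p → DegLe 0 q → Label j (p * q)
    Label-*-constant j (p-univ , p-deg) q-const =
      Univariate-* j p-univ (constant⇒Univariate j q-const) ,
      DegLe-mono (ℕ.≤-reflexive (ℕ.+-identityʳ D)) (DegLe-* D 0 p-deg q-const)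

    edge-Label : ∀ l (l<n : l < n) a b → Label (fromℕ< l<n) (edge l a b)
    edge-Label zero l<n _ = first (0 ℕ.<ᵇ n′)
      where
      j : Fin n
      j = fromℕ< l<n
      T-Label : ∀ a b → Label j (T 0 a b)
      T-Label a b = T-univariate 0 l<n a b , T-degree 0 l<n a b
      rowProduct-Label : ∀ b → Label j (rowProduct 1 b)
      rowProduct-Label b = Label-sum j _ (λ a → constant-*-Label j (u-constant a) (T-Label a b))
      first : ∀ γ b → Label j (levelValue 1 γ b)
      first true  b = rowProduct-Label b
      first false _ = Label-sum j _ (λ b → Label-*-constant j (rowProduct-Label b) (v-constant b))
    edge-Label (suc l) l<n = later (l ℕ.<ᵇ n′) (suc l ℕ.<ᵇ n′)
      where
      j : Fin n
      j = fromℕ< l<n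
      T-Label : ∀ a b → Label j (T (suc l) a b)
      T-Label a b = T-univariate (suc l) l<n a b , T-degree (suc l) l<n a b
      later : ∀ β γ a b → Label j (laterEdge (suc l) β γ a b)
      later true  true  a b = T-Label a b
      later true  false a _ = Label-sum j _ (λ b → Label-*-constant j (T-Label a b) (v-constant b))
      later false _     _ _ = Univariate-zeroP j , DegLe-zeroP D

    roabp : ROABP n
    roabp = record
      { w      = width
      ; source = ≡.refl
      ; sink   = ≡.cong layerWidth (<ᵇ-irrefl n′)
      ; label  = λ l l<n a b → toUnivariate D (fromℕ< l<n) (edge l a b)
      }

    reach≈vertexValue : ∀ l (l≤n : l ≤ n) a → ROABP.reach roabp l l≤n a ≈ vertexValue l a
    reach≈vertexValue zero    _   _ = refl
    reach≈vertexValue (suc l) l<n b = begin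
      ΣP (width l) (λ a → ROABP.reach roabp l (ℕ.<⇒≤ l<n) a *P embed j (toUnivariate D j (edge l a b)))
        ≈⟨ ΣP≈sum (width l) _ ⟩
      ∑[ a < width l ] (ROABP.reach roabp l (ℕ.<⇒≤ l<n) a * embed j (toUnivariate D j (edge l a b)))
        ≈⟨ sum-cong-≋ (λ a → *-cong (reach≈vertexValue l (ℕ.<⇒≤ l<n) a)
             (embed-toUnivariate D j (proj₁ (edge-Label l l<n a b)) (proj₂ (edge-Label l l<n a b)))) ⟩
      ∑[ a < width l ] (vertexValue l a * edge l a b) ≈⟨ vertexValue-step l l<n b ⟨
      vertexValue (suc l) b ∎
      where j = fromℕ< l<n

    roabp-value : ROABP.value roabp ≈ result
    roabp-value = begin
      ΣP (width n) (ROABP.reach roabp n ℕ.≤-refl)  ≈⟨ ΣP≈sum (width n) _ ⟩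
      ∑[ a < width n ] ROABP.reach roabp n ℕ.≤-refl a ≈⟨ sum-cong-≋ (reach≈vertexValue n ℕ.≤-refl) ⟩
      ∑[ a < width n ] vertexValue n a              ≈⟨ sink (n′ ℕ.<ᵇ n′) (<ᵇ-irrefl n′) ⟩
      result                                        ∎
      where
      sink : ∀ β → β ≡ false → ∑[ a < layerWidth β ] levelValue n β a ≈ result
      sink false _ = +-identityʳ result

    roabp-width : 1 ≤ N → ROABP.width roabp ≤ N
    roabp-width 1≤N = maxℕ-lub (suc n) _ (λ l → width≤N (toℕ l))
      where
      layerWidth≤N : ∀ β → layerWidth β ≤ N
      layerWidth≤N true  = ℕ.≤-refl
      layerWidth≤N false = 1≤N
      width≤N : ∀ l → width l ≤ N
      width≤N zero    = 1≤N
      width≤N (suc l) = layerWidth≤N (l ℕ.<ᵇ n′)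

    roabp-labelDegree : ROABP.LabelDegLe roabp D
    roabp-labelDegree l l<n a b = toUnivariate-degree D (fromℕ< l<n) (edge l a b)

-- Diagonal depth-4 circuits

module DiagonalCircuit {c ℓ} (R : CommutativeRing c ℓ) (n′ : ℕ) (Φ : Poly.Diag4 R (suc n′)) where
  open Poly R using (MPoly; DegLe; embed; ΣP; ΠP; _^P_; ROABP)
  open Poly.Diag4 Φ
  open Polynomials R
  open PolynomialDegree R (suc n′)
  open CommutativeSemiring (polynomialSemiring {suc n′}) hiding (zero)
  open Sums (polynomialSemiring {suc n′})
  open BinomialShift (polynomialSemiring {suc n′})
  open import Relation.Binary.Reasoning.Setoid setoid

  summands : (i : Fin k) → Fin (t i) → Fin (suc n′) → MPoly (suc n′)
  summands i j v = embed v (g i j v)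

  boxSize : Fin k → ℕ
  boxSize i = ∣ e i ∣×

  N : ℕ
  N = sumℕ k boxSize

  -- The monomial ∏_j S_{i,j,l}^{x_j} of term i, for the point x of the box 0 ≤ x ≤ e_i.
  state : ℕ → Block k boxSize → MPoly (suc n′)
  state l (i , x) = monomial (e i) (λ j → prefixSum (summands i j) l) x

  transition : ℕ → Block k boxSize → Block k boxSize → MPoly (suc n′)
  transition l (i , x) (i′ , y) with i Fin.≟ i′
  ... | yes ≡.refl = shift (e i) (λ j → pad (summands i j) l) x y
  ... | no  _      = 0#

  transition-diagonal : ∀ l i x y →
    transition l (i , x) (i , y) ≡ shift (e i) (λ j → pad (summands i j) l) x y
  transition-diagonal l i x y with i Fin.≟ i
  ... | yes ≡.refl = ≡.refl
  ... | no  i≢i    = ⊥-elim (i≢i ≡.refl)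

  transition-offDiagonal : ∀ l {i i′} x y → ¬ i ≡ i′ → transition l (i , x) (i′ , y) ≡ 0#
  transition-offDiagonal l {i} {i′} x y i≢i′ with i Fin.≟ i′
  ... | yes i≡i′ = ⊥-elim (i≢i′ i≡i′)
  ... | no  _    = ≡.refl

  state-step : ∀ l b →
    ∑[ s < N ] (state l (toBlock k boxSize s) * transition l (toBlock k boxSize s) b) ≈ state (suc l) b
  state-step l (i′ , y) = begin
    ∑[ s < N ] (state l (toBlock k boxSize s) * transition l (toBlock k boxSize s) (i′ , y))
      ≈⟨ sum-blocks k boxSize (λ b → state l b * transition l b (i′ , y)) ⟩
    ∑[ i < k ] ∑[ x < boxSize i ] (state l (i , x) * transition l (i , x) (i′ , y))
      ≈⟨ sum-single _ i′ (λ i i≢i′ → sum-zero _ (λ x →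
           trans (*-congˡ (reflexive (transition-offDiagonal l x y i≢i′))) (zeroʳ _))) ⟩
    ∑[ x < boxSize i′ ] (state l (i′ , x) * transition l (i′ , x) (i′ , y))
      ≈⟨ sum-cong-≋ (λ x → *-congˡ (reflexive (transition-diagonal l i′ x y))) ⟩
    ∑[ x < boxSize i′ ] (state l (i′ , x) * shift (e i′) (λ j → pad (summands i′ j) l) x y)
      ≈⟨ monomial-shift (e i′) _ _ y ⟩
    state (suc l) (i′ , y) ∎

  isTop : Block k boxSize → MPoly (suc n′)
  isTop (i , x) with x Fin.≟ top (e i)
  ... | yes _ = 1#
  ... | no  _ = 0#

  sum-*-isTop : ∀ i (f : Fin (boxSize i) → MPoly (suc n′)) →
    ∑[ x < boxSize i ] (f x * isTop (i , x)) ≈ f (top (e i))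
  sum-*-isTop i f = trans (sum-single _ (top (e i)) off-top) at-top
    where
    off-top : ∀ x → ¬ x ≡ top (e i) → f x * isTop (i , x) ≈ 0#
    off-top x x≢top with x Fin.≟ top (e i)
    ... | yes x≡top = ⊥-elim (x≢top x≡top)
    ... | no  _     = zeroʳ (f x)
    at-top : f (top (e i)) * isTop (i , top (e i)) ≈ f (top (e i))
    at-top with top (e i) Fin.≟ top (e i)
    ... | yes _       = *-identityʳ _
    ... | no  top≢top = ⊥-elim (top≢top ≡.refl)

  initial : Fin N → MPoly (suc n′)
  initial = state 0 ∘ toBlock k boxSize

  final : Fin N → MPoly (suc n′)
  final = isTop ∘ toBlock k boxSize

  step : ℕ → Fin N → Fin N → MPoly (suc n′)
  step l a b = transition l (toBlock k boxSize a) (toBlock k boxSize b)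

  module Product = MatrixProductROABP R n′ N initial final step
  open Product using (rowProduct; result)

  rowProduct≈state : ∀ l s → rowProduct l s ≈ state l (toBlock k boxSize s)
  rowProduct≈state zero    s = refl
  rowProduct≈state (suc l) s =
    trans (sum-cong-≋ (λ a → *-congʳ (rowProduct≈state l a))) (state-step l (toBlock k boxSize s))

  result≈value : result ≈ value
  result≈value = begin
    ∑[ s < N ] (rowProduct (suc n′) s * isTop (toBlock k boxSize s))
      ≈⟨ sum-cong-≋ (λ s → *-congʳ (rowProduct≈state (suc n′) s)) ⟩
    ∑[ s < N ] (state (suc n′) (toBlock k boxSize s) * isTop (toBlock k boxSize s))
      ≈⟨ sum-blocks k boxSize (λ b → state (suc n′) b * isTop b) ⟩
    ∑[ i < k ] ∑[ x < boxSize i ] (state (suc n′) (i , x) * isTop (i , x))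
      ≈⟨ sum-cong-≋ (λ i → sum-*-isTop i (λ x → state (suc n′) (i , x))) ⟩
    ∑[ i < k ] state (suc n′) (i , top (e i))
      ≈⟨ sum-cong-≋ (λ i → product-cong (λ j → ^-cong (prefixSum-total (summands i j)) (digits-top (e i) j))) ⟩
    ∑[ i < k ] product (λ j → sum (summands i j) ^ e i j)
      ≈⟨ sum-cong-≋ (λ i → product-cong (λ j →
           trans (^P≈^ (P i j) (e i j)) (^-congˡ (e i j) (ΣP≈sum (suc n′) (summands i j))))) ⟨
    ∑[ i < k ] product (λ j → P i j ^P e i j)
      ≈⟨ sum-cong-≋ (λ i → ΠP≈product (t i) (λ j → P i j ^P e i j)) ⟨
    ∑[ i < k ] Ψ i
      ≈⟨ ΣP≈sum k Ψ ⟨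
    value ∎

  state₀-constant : ∀ b → DegLe 0 (state 0 b)
  state₀-constant (i , x) = product-closed (DegLe 0) DegLe-oneP (DegLe-* 0 0) _
    (λ j → ^-closed (DegLe 0) DegLe-oneP (DegLe-* 0 0) (digits (e i) x j) (DegLe-zeroP 0))

  isTop-constant : ∀ b → DegLe 0 (isTop b)
  isTop-constant (i , x) with x Fin.≟ top (e i)
  ... | yes _ = DegLe-oneP
  ... | no  _ = DegLe-zeroP 0

  transition-univariate : ∀ l (l<n : l < suc n′) a b → Univariate (fromℕ< l<n) (transition l a b)
  transition-univariate l l<n (i , x) (i′ , y) with i Fin.≟ i′
  ... | no  _      = Univariate-zeroP (fromℕ< l<n)
  ... | yes ≡.refl = product-closed (Univariate v) (Univariate-oneP v) (Univariate-* v) _ (λ j →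
        ×-closed (Univariate v) (Univariate-zeroP v) (Univariate-+ v) (y′ j C x′ j)
          (^-closed (Univariate v) (Univariate-oneP v) (Univariate-* v) (y′ j ∸ x′ j) (piece-univariate j)))
    where
    v  = fromℕ< l<n
    x′ = digits (e i) x
    y′ = digits (e i) y
    piece-univariate : ∀ j → Univariate v (pad (summands i j) l)
    piece-univariate j =
      ≡.subst (Univariate v) (≡.sym (pad-fromℕ< (summands i j) l<n)) (Univariate-embed v (g i j v))

  module Bounds (D : ℕ) (d : (i : Fin k) → Fin (t i) → ℕ) (P-degree : ∀ i j → DegLe (d i j) (P i j))
           (sdeg≤D : ∀ i → sumℕ (t i) (λ j → e i j ℕ.* d i j) ≤ D) where

    transition-degree : ∀ l a b → DegLe D (transition l a b)
    transition-degree l (i , x) (i′ , y) with i Fin.≟ i′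
    ... | no  _      = DegLe-zeroP D
    ... | yes ≡.refl = DegLe-mono shift-degree≤D (DegLe-product δ _ (λ j →
          ×-closed (DegLe (δ j)) (DegLe-zeroP (δ j)) (DegLe-+ (δ j)) (y′ j C x′ j)
            (DegLe-^ (d i j) (y′ j ∸ x′ j) (piece-degree j))))
      where
      x′ = digits (e i) x
      y′ = digits (e i) y
      δ  = λ j → (y′ j ∸ x′ j) ℕ.* d i j
      piece-degree : ∀ j → DegLe (d i j) (pad (summands i j) l)
      piece-degree j = pad-closed (DegLe (d i j)) (DegLe-zeroP (d i j)) (DegLe-+ (d i j)) (summands i j)
                                  (DegLe-summand (d i j) (g i j) (P-degree i j)) l
      shift-degree≤D : sumℕ (t i) δ ≤ D
      shift-degree≤D = ℕ.≤-trans (sumℕ-mono (t i) {δ} (λ j → ℕ.*-monoˡ-≤ (d i j)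
                         (ℕ.≤-trans (ℕ.m∸n≤m (y′ j) (x′ j)) (digits-≤ (e i) y j)))) (sdeg≤D i)

    module Labelled = Product.Construction D
      (state₀-constant ∘ toBlock k boxSize) (isTop-constant ∘ toBlock k boxSize)
      (λ l l<n a b → transition-univariate l l<n (toBlock k boxSize a) (toBlock k boxSize b))
      (λ l _ a b → transition-degree l (toBlock k boxSize a) (toBlock k boxSize b))

    roabp-computes-Φ : ROABP.value Labelled.roabp ≈ value
    roabp-computes-Φ = trans Labelled.roabp-value result≈value

  1≤N : 1 ≤ k → 1 ≤ N
  1≤N 1≤k = 1≤sumℕ k boxSize 1≤k (1≤∣∣× ∘ e)

  N≤widthBound : N ≤ widthBound
  N≤widthBound = sumℕ≤*maxℕ k boxSize

open import Data.Nat using (_*_)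

mainTheorem20 : ∀ {c ℓ : Level} (F : Field c ℓ) →
    let open Poly (Field.ring F) in
    (n : ℕ) (Φ : Diag4 n) →
    1 ≤ n → 1 ≤ Diag4.k Φ →
    (D : ℕ) (d : (i : Fin (Diag4.k Φ)) → Fin (Diag4.t Φ i) → ℕ) →
    (∀ i j → DegLe (d i j) (Diag4.P Φ i j)) →
    (∀ i → sumℕ (Diag4.t Φ i) (λ j → Diag4.e Φ i j * d i j) ≤ D) →
    Σ (ROABP n) (λ A →
      (ROABP.value A ≈P Diag4.value Φ)
      × (ROABP.width A ≤ Diag4.widthBound Φ)
      × ROABP.LabelDegLe A D)
mainTheorem20 F (suc n′) Φ _ 1≤k D d P-degree sdeg≤D =
  Labelled.roabp , roabp-computes-Φ ,
  ℕ.≤-trans (Labelled.roabp-width (1≤N 1≤k)) N≤widthBound , Labelled.roabp-labelDegree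
  where
  open DiagonalCircuit (Field.ring F) n′ Φ
  open Bounds D d P-degree sdeg≤D
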